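{- If $G$ is a finite directed acyclic graph with at least one edge, then \[\tilde{\chi}(\mathrm{DT}(G))=-\prod_{v\in V(G)\setminus R}(1-d^-(v)),\] where $R$ is the set of vertices of $G$ with no edges directed to them.
   Context: A directed acyclic graph is a directed graph without directed cycles. A directed forest in $G$ is a set $F$ of edges of $G$ with at most one edge of $F$ directed to each vertex and no directed cycle. $\mathrm{DT}(G)$ is the simplicial complex with vertex set $E(G)$ whose faces are the edge sets of directed forests of $G$ (including the empty face). $d^-(v)$ is the number of edges of $G$ directed to $v$, and $\tilde\chi$ is the reduced Euler characteristic, $\tilde\chi(\Delta)=\sum_{i\ge 0}(-1)^{i+1}\alpha(i)$ where $\alpha(i)$ is the number of faces with $i$ vertices. -}

module Defs where

open import Data.Bool using (Bool; true; false; if_then_else_)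
open import Data.Nat as ℕ using (ℕ; zero; suc; _≤_)
open import Data.Integer as ℤ using (ℤ; +_; -_; _-_; _*_; _+_)
open import Data.Fin using (Fin)
open import Data.Fin.Properties using () renaming (_≟_ to _≟F_)
open import Data.List using (List; []; _∷_; _++_; map; filter; length; foldr; upTo; allFin; concatMap)
open import Data.List.Membership.Propositional using (_∈_)
open import Data.Product using (_×_; _,_; proj₁; proj₂; Σ; ∃)
open import Relation.Nullary using (¬_; Dec; does)
open import Relation.Nullary.Decidable using (¬?)
open import Data.Bool.Properties using () renaming (_≟_ to _≟B_)
open import Relation.Binary.PropositionalEquality using (_≡_)

-- A finite simple directed graph on the vertex set Fin n, given by its
-- adjacency relation: adj u v ≡ true iff there is an edge u → v.
Digraph : ℕ → Set
Digraph n = Fin n → Fin n → Bool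

Edge : ℕ → Set
Edge n = Fin n × Fin n

data Path {n : ℕ} (R : Fin n → Fin n → Set) : Fin n → Fin n → Set where
  one  : ∀ {u v} → R u v → Path R u v
  step : ∀ {u w v} → R u w → Path R w v → Path R u v

Acyclic : ∀ {n} → Digraph n → Set
Acyclic {n} G = ∀ (v : Fin n) → ¬ Path (λ u w → G u w ≡ true) v v

edges : ∀ {n} → Digraph n → List (Edge n)
edges {n} G = filter (λ e → G (proj₁ e) (proj₂ e) ≟B true)
                (concatMap (λ u → map (λ v → (u , v)) (allFin n)) (allFin n))

subsets : ∀ {A : Set} → List A → List (List A)
subsets [] = [] ∷ []
subsets (x ∷ xs) = subsets xs ++ map (x ∷_) (subsets xs)

inDegIn : ∀ {n} → List (Edge n) → Fin n → ℕ
inDegIn F v = length (filter (λ e → proj₂ e ≟F v) F)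

IsDirectedForest : ∀ {n} → List (Edge n) → Set
IsDirectedForest {n} F =
  (∀ (v : Fin n) → inDegIn F v ≤ 1) ×
  (∀ (v : Fin n) → ¬ Path (λ u w → (u , w) ∈ F) v v)

-- Faces of DT(G): edge sets of directed forests of G (computed with a
-- given decision procedure for IsDirectedForest; the result does not depend
-- on which decider is used).
faces : ∀ {n} (G : Digraph n) →
        (∀ F → Dec (IsDirectedForest {n} F)) → List (List (Edge n))
faces G dec = filter dec (subsets (edges G))

α : ∀ {n} (G : Digraph n) → (∀ F → Dec (IsDirectedForest {n} F)) → ℕ → ℕ
α G dec i = length (filter (λ F → length F ℕ.≟ i) (faces G dec))

sumℤ : List ℤ → ℤ
sumℤ = foldr _+_ (+ 0)

productℤ : List ℤ → ℤ
productℤ = foldr _*_ (+ 1)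

sgn : ℕ → ℤ
sgn zero = + 1
sgn (suc k) = - sgn k

-- Reduced Euler characteristic χ̃(DT(G)) = Σ_{i ≥ 0} (-1)^{i+1} α(i);
-- faces have at most |E(G)| vertices so i ranges over 0..|E(G)|.
redEuler : ∀ {n} (G : Digraph n) → (∀ F → Dec (IsDirectedForest {n} F)) → ℤ
redEuler G dec =
  sumℤ (map (λ i → sgn (suc i) * + α G dec i) (upTo (suc (length (edges G)))))

inDeg : ∀ {n} → Digraph n → Fin n → ℕ
inDeg {n} G v = length (filter (λ u → G u v ≟B true) (allFin n))

nonRoots : ∀ {n} → Digraph n → List (Fin n)
nonRoots {n} G = filter (λ v → ¬? (inDeg G v ℕ.≟ 0)) (allFin n)

{-# OPTIONS --safe #-}
module Submission where

-- Every edge set of an acyclic graph is cycle-free, so the faces of DT(G) are exactly the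
-- edge sets with at most one edge into each vertex. Such a set is an independent choice, at
-- every vertex v, of nothing or one of the d⁻(v) edges into v; hence the signed face count
-- Σ_F (-1)^|F| factors as Π_v (1 - d⁻(v)), in which the vertices of R contribute 1, and
-- χ̃(DT(G)) is its negative. The factorisation is proved by adding the edges one at a time,
-- keeping track of the vertices that already have their incoming edge.

open import Defs
import Data.Integer.Properties as ℤ
open import Algebra.Properties.CommutativeMonoid.Sum ℤ.*-1-commutativeMonoid using ()
  renaming ( sum to ∏; sum-cong-≗ to ∏-cong; sum-remove to ∏-remove
           ; sum-replicate-zero to ∏-replicate-one)
open import Data.Bool using (Bool; true; false; if_then_else_; not; _∧_; _∨_)
open import Data.Bool.Properties using (∨-zeroʳ; ∨-identityʳ; if-float) renaming (_≟_ to _≟B_)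
open import Data.Fin using (Fin; zero; suc; punchIn)
open import Data.Fin.Properties using (punchInᵢ≢i) renaming (_≟_ to _≟F_)
open import Data.Integer using (ℤ; +_; -_; _-_; _*_; _+_)
open import Data.Integer.Tactic.RingSolver using (solve-∀)
open import Data.List
  using (List; []; _∷_; _++_; map; filter; length; upTo; allFin; tabulate; concatMap)
open import Data.List.Properties
  using ( map-++; map-∘; map-cong; map-cong-local; map-tabulate; length-map
        ; filter-accept; filter-reject; filter-none; filter-++)
open import Data.List.Membership.Propositional using (_∈_)
open import Data.List.Membership.Propositional.Properties
  using (∈-filter⁻; ∈-++⁻; ∈-map⁻; ∈-upTo⁺; ∈-allFin)
open import Data.List.Relation.Unary.All as All using (All; []; _∷_)
open import Data.List.Relation.Unary.Any using (here; there)
open import Data.List.Relation.Unary.Unique.Propositional using (Unique; []; _∷_)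
open import Data.List.Relation.Unary.Unique.Propositional.Properties using (upTo⁺; allFin⁺)
open import Data.List.Relation.Binary.Sublist.Propositional as Sublist using (_⊆_; []; _∷_; _∷ʳ_)
open import Data.List.Relation.Binary.Sublist.Propositional.Properties using (length-mono-≤)
open import Data.Nat as ℕ using (ℕ; zero; suc; _≤_; _<_; z≤n; s≤s)
open import Data.Nat.Properties using (≤-trans)
open import Data.Product using (_×_; _,_; proj₁; proj₂; ∃₂)
open import Data.Sum using (inj₁; inj₂)
open import Data.Vec.Functional using (Vector; removeAt)
open import Function using (id; _∘_; const; _⇔_; Equivalence; mk⇔)
open import Relation.Binary.Definitions using (DecidableEquality)
open import Relation.Binary.PropositionalEquality
open import Relation.Nullary using (¬_; Dec; does; yes; no)
open import Relation.Nullary.Decidable using (dec-true; dec-false; decidable-stable; ¬?)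
open import Relation.Unary using (Decidable)

private
  variable
    A B : Set
    n : ℕ

sumℤ-++ : ∀ (xs ys : List ℤ) → sumℤ (xs ++ ys) ≡ sumℤ xs + sumℤ ys
sumℤ-++ []       ys = sym (ℤ.+-identityˡ _)
sumℤ-++ (x ∷ xs) ys = trans (cong (_+_ x) (sumℤ-++ xs ys)) (sym (ℤ.+-assoc x _ _))

sumℤ-map-+ : ∀ (f g : A → ℤ) xs →
             sumℤ (map (λ x → f x + g x) xs) ≡ sumℤ (map f xs) + sumℤ (map g xs)
sumℤ-map-+ f g []       = refl
sumℤ-map-+ f g (x ∷ xs) =
  trans (cong (_+_ (f x + g x)) (sumℤ-map-+ f g xs)) (interchange (f x) (g x) _ _)
  where
  interchange : ∀ a b c d → a + b + (c + d) ≡ a + c + (b + d)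
  interchange = solve-∀

sumℤ-map-neg : ∀ (f : A → ℤ) xs → sumℤ (map (λ x → - f x) xs) ≡ - sumℤ (map f xs)
sumℤ-map-neg f []       = refl
sumℤ-map-neg f (x ∷ xs) =
  trans (cong (_+_ (- f x)) (sumℤ-map-neg f xs)) (sym (ℤ.neg-distrib-+ (f x) _))

sumℤ-map-zero : ∀ {f : A → ℤ} xs → (∀ x → f x ≡ + 0) → sumℤ (map f xs) ≡ + 0
sumℤ-map-zero []       _   = refl
sumℤ-map-zero (x ∷ xs) f≡0 = cong₂ _+_ (f≡0 x) (sumℤ-map-zero xs f≡0)

module _ {P : A → Set} (P? : Decidable P) where

  sumℤ-map-filter : ∀ (f : A → ℤ) xs →
    sumℤ (map f (filter P? xs)) ≡ sumℤ (map (λ x → if does (P? x) then f x else + 0) xs)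
  sumℤ-map-filter f []       = refl
  sumℤ-map-filter f (x ∷ xs) with does (P? x)
  ... | true  = cong (_+_ (f x)) (sumℤ-map-filter f xs)
  ... | false = trans (sumℤ-map-filter f xs) (sym (ℤ.+-identityˡ _))

  filter-map : ∀ (f : B → A) xs → filter P? (map f xs) ≡ map f (filter (P? ∘ f) xs)
  filter-map f []       = refl
  filter-map f (x ∷ xs) with does (P? (f x))
  ... | true  = cong (f x ∷_) (filter-map f xs)
  ... | false = filter-map f xs

  filter-comm : ∀ {Q : A → Set} (Q? : Decidable Q) xs →
                filter P? (filter Q? xs) ≡ filter Q? (filter P? xs)
  filter-comm Q? []       = refl
  filter-comm Q? (x ∷ xs) with does (Q? x) in qx | does (P? x) in px
  ... | true  | true  rewrite px | qx = cong (x ∷_) (filter-comm Q? xs)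
  ... | true  | false rewrite px = filter-comm Q? xs
  ... | false | true  rewrite qx = filter-comm Q? xs
  ... | false | false = filter-comm Q? xs

module _ (_≟_ : DecidableEquality A) where

  filter-≟-unique : ∀ {v xs} → Unique xs → v ∈ xs → filter (_≟ v) xs ≡ v ∷ []
  filter-≟-unique (x∉xs ∷ _) (here refl) =
    trans (filter-accept (_≟ _) refl) (cong (_ ∷_) (filter-none (_≟ _) (All.map (_∘ sym) x∉xs)))
  filter-≟-unique (x∉xs ∷ xs!) (there v∈xs) =
    trans (filter-reject (_≟ _) (All.lookup x∉xs v∈xs)) (filter-≟-unique xs! v∈xs)

  sumℤ-select : ∀ (g : A → ℤ) {v xs} → Unique xs → v ∈ xs →
                sumℤ (map (λ x → if does (x ≟ v) then g x else + 0) xs) ≡ g v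
  sumℤ-select g {v} {xs} xs! v∈xs = begin
    sumℤ (map (λ x → if does (x ≟ v) then g x else + 0) xs)
      ≡⟨ sumℤ-map-filter (_≟ v) g xs ⟨
    sumℤ (map g (filter (_≟ v) xs))
      ≡⟨ cong (sumℤ ∘ map g) (filter-≟-unique xs! v∈xs) ⟩
    g v + + 0
      ≡⟨ ℤ.+-identityʳ (g v) ⟩
    g v ∎
    where open ≡-Reasoning

sumℤ-fibres : ∀ (f : A → ℕ) (g : ℕ → ℤ) k xs → All (λ x → f x < k) xs →
  sumℤ (map (λ i → g i * + length (filter (λ x → f x ℕ.≟ i) xs)) (upTo k))
    ≡ sumℤ (map (g ∘ f) xs)
sumℤ-fibres     f g k []       []            = sumℤ-map-zero (upTo k) (λ i → ℤ.*-zeroʳ (g i))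
sumℤ-fibres {A} f g k (x ∷ xs) (fx<k ∷ xs<k) = begin
  sumℤ (map (λ i → g i * + fibre (x ∷ xs) i) (upTo k))
    ≡⟨ cong sumℤ (map-cong split (upTo k)) ⟩
  sumℤ (map (λ i → (if does (i ℕ.≟ f x) then g i else + 0) + g i * + fibre xs i) (upTo k))
    ≡⟨ sumℤ-map-+ _ _ (upTo k) ⟩
  sumℤ (map (λ i → if does (i ℕ.≟ f x) then g i else + 0) (upTo k))
    + sumℤ (map (λ i → g i * + fibre xs i) (upTo k))
    ≡⟨ cong₂ _+_ (sumℤ-select ℕ._≟_ g (upTo⁺ k) (∈-upTo⁺ fx<k))
                 (sumℤ-fibres f g k xs xs<k) ⟩
  g (f x) + sumℤ (map (g ∘ f) xs) ∎
  where
  open ≡-Reasoning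
  fibre : List A → ℕ → ℕ
  fibre ys i = length (filter (λ y → f y ℕ.≟ i) ys)
  split : ∀ i → g i * + fibre (x ∷ xs) i
              ≡ (if does (i ℕ.≟ f x) then g i else + 0) + g i * + fibre xs i
  split i with i ℕ.≟ f x
  ... | yes refl rewrite dec-true (f x ℕ.≟ f x) refl = ℤ.*-suc (g i) (+ fibre xs i)
  ... | no i≢fx  rewrite dec-false (i ℕ.≟ f x) i≢fx
                       | dec-false (f x ℕ.≟ i) (i≢fx ∘ sym) = sym (ℤ.+-identityˡ _)

∈-subsets⇒⊆ : ∀ {F E : List A} → F ∈ subsets E → F ⊆ E
∈-subsets⇒⊆ {E = []}    (here refl) = []
∈-subsets⇒⊆ {E = x ∷ E} F∈ with ∈-++⁻ (subsets E) F∈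
... | inj₁ F∈subsetsE = x ∷ʳ ∈-subsets⇒⊆ F∈subsetsE
... | inj₂ F∈x∷subsetsE with F′ , F′∈subsetsE , refl ← ∈-map⁻ (x ∷_) F∈x∷subsetsE =
  refl ∷ ∈-subsets⇒⊆ F′∈subsetsE

∏-split : ∀ {f g h : Vector ℤ n} w → f w ≡ g w - h w →
          (∀ {v} → w ≢ v → f v ≡ g v) → (∀ {v} → w ≢ v → h v ≡ g v) →
          ∏ f ≡ ∏ g - ∏ h
∏-split {suc n} {f} {g} {h} w fw≡gw-hw f≡g h≡g = begin
  ∏ f
    ≡⟨ ∏-remove f ⟩
  f w * ∏ (removeAt f w)
    ≡⟨ cong₂ _*_ fw≡gw-hw (∏-cong (f≡g ∘ away)) ⟩
  (g w - h w) * ∏ (removeAt g w)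
    ≡⟨ *-distribʳ-- (g w) (h w) _ ⟩
  g w * ∏ (removeAt g w) - h w * ∏ (removeAt g w)
    ≡⟨ cong (λ r → g w * ∏ (removeAt g w) - h w * r) (∏-cong (h≡g ∘ away)) ⟨
  g w * ∏ (removeAt g w) - h w * ∏ (removeAt h w)
    ≡⟨ cong₂ _-_ (∏-remove g) (∏-remove h) ⟨
  ∏ g - ∏ h ∎
  where
  open ≡-Reasoning
  away : ∀ j → w ≢ punchIn w j
  away j = punchInᵢ≢i w j ∘ sym
  *-distribʳ-- : ∀ a b c → (a - b) * c ≡ a * c - b * c
  *-distribʳ-- = solve-∀

productℤ-tabulate : ∀ (f : Fin n → ℤ) → productℤ (tabulate f) ≡ ∏ f
productℤ-tabulate {zero}  f = refl
productℤ-tabulate {suc n} f = cong (_*_ (f zero)) (productℤ-tabulate (f ∘ suc))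

productℤ-filter : ∀ {P : A → Set} (P? : Decidable P) (f : A → ℤ) xs →
                  (∀ x → ¬ P x → f x ≡ + 1) →
                  productℤ (map f (filter P? xs)) ≡ productℤ (map f xs)
productℤ-filter P? f []       _      = refl
productℤ-filter P? f (x ∷ xs) ¬P⇒f≡1 with P? x
... | yes _  = cong (_*_ (f x)) (productℤ-filter P? f xs ¬P⇒f≡1)
... | no ¬Px rewrite ¬P⇒f≡1 x ¬Px =
  trans (productℤ-filter P? f xs ¬P⇒f≡1) (sym (ℤ.*-identityˡ _))

Path-map : ∀ {R S : Fin n → Fin n → Set} → (∀ {u w} → R u w → S u w) →
           ∀ {u v} → Path R u v → Path S u v
Path-map R⇒S (one r)    = one (R⇒S r)
Path-map R⇒S (step r p) = step (R⇒S r) (Path-map R⇒S p)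

isEdge? : ∀ (G : Digraph n) (e : Edge n) → Dec (G (proj₁ e) (proj₂ e) ≡ true)
isEdge? G e = G (proj₁ e) (proj₂ e) ≟B true

vertexPairs : ∀ n → List (Edge n)
vertexPairs n = concatMap (λ u → map (u ,_) (allFin n)) (allFin n)

∈-edges⁻ : ∀ (G : Digraph n) {u w} → (u , w) ∈ edges G → G u w ≡ true
∈-edges⁻ {n} G e∈E = proj₂ (∈-filter⁻ (isEdge? G) {xs = vertexPairs n} e∈E)

subgraph-acyclic : ∀ {G : Digraph n} {F} → Acyclic G → F ⊆ edges G →
                   ∀ v → ¬ Path (λ u w → (u , w) ∈ F) v v
subgraph-acyclic {G = G} acyclic F⊆E v cycle =
  acyclic v (Path-map (∈-edges⁻ G ∘ Sublist.lookup F⊆E) cycle)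

filter-≟-allFin : ∀ (v : Fin n) → filter (_≟F v) (allFin n) ≡ v ∷ []
filter-≟-allFin {n} v = filter-≟-unique _≟F_ (allFin⁺ n) (∈-allFin v)

edges-into : ∀ (G : Digraph n) v →
  filter (λ e → proj₂ e ≟F v) (edges G) ≡ map (_, v) (filter (λ u → G u v ≟B true) (allFin n))
edges-into {n} G v = begin
  filter into? (filter (isEdge? G) (vertexPairs n))
    ≡⟨ filter-comm into? (isEdge? G) (vertexPairs n) ⟩
  filter (isEdge? G) (filter into? (vertexPairs n))
    ≡⟨ cong (filter (isEdge? G)) (pairs-into (allFin n)) ⟩
  filter (isEdge? G) (map (_, v) (allFin n))
    ≡⟨ filter-map (isEdge? G) (_, v) (allFin n) ⟩
  map (_, v) (filter (λ u → G u v ≟B true) (allFin n)) ∎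
  where
  open ≡-Reasoning
  into? : ∀ (e : Edge n) → Dec (proj₂ e ≡ v)
  into? e = proj₂ e ≟F v
  row : Fin n → List (Edge n)
  row u = map (u ,_) (allFin n)
  pairs-into : ∀ us → filter into? (concatMap row us) ≡ map (_, v) us
  pairs-into []       = refl
  pairs-into (u ∷ us) = begin
    filter into? (row u ++ concatMap row us)
      ≡⟨ filter-++ into? (row u) (concatMap row us) ⟩
    filter into? (row u) ++ filter into? (concatMap row us)
      ≡⟨ cong₂ _++_ (filter-map into? (u ,_) (allFin n)) (pairs-into us) ⟩
    map (u ,_) (filter (_≟F v) (allFin n)) ++ map (_, v) us
      ≡⟨ cong (λ vs → map (u ,_) vs ++ map (_, v) us) (filter-≟-allFin v) ⟩
    (u , v) ∷ map (_, v) us ∎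

inDegIn-edges : ∀ (G : Digraph n) v → inDegIn (edges G) v ≡ inDeg G v
inDegIn-edges {n} G v =
  trans (cong length (edges-into G v)) (length-map (_, v) (filter (λ u → G u v ≟B true) (allFin n)))

inDegIn-∷-head : ∀ (u w : Fin n) F → inDegIn ((u , w) ∷ F) w ≡ suc (inDegIn F w)
inDegIn-∷-head u w F = cong length (filter-accept (λ e → proj₂ e ≟F w) refl)

inDegIn-∷-other : ∀ (u : Fin n) {w v} F → w ≢ v → inDegIn ((u , w) ∷ F) v ≡ inDegIn F v
inDegIn-∷-other u {v = v} F w≢v = cong length (filter-reject (λ e → proj₂ e ≟F v) w≢v)

-- covered v means that v already has its incoming edge. Generalising from the empty
-- covering (const false), whose admissible sets are the faces, is what lets
-- signedCount≡∏factor be proved edge by edge.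
cover : (Fin n → Bool) → Fin n → Fin n → Bool
cover covered w v = covered v ∨ does (w ≟F v)

cover-self : ∀ (covered : Fin n → Bool) w → cover covered w w ≡ true
cover-self covered w rewrite dec-true (w ≟F w) refl = ∨-zeroʳ (covered w)

cover-other : ∀ (covered : Fin n → Bool) {w v} → w ≢ v → cover covered w v ≡ covered v
cover-other covered {w} {v} w≢v rewrite dec-false (w ≟F v) w≢v = ∨-identityʳ (covered v)

capacity : (Fin n → Bool) → Fin n → ℕ
capacity covered v = if covered v then 0 else 1

capacity≤1 : ∀ (covered : Fin n → Bool) v → capacity covered v ≤ 1
capacity≤1 covered v with covered v
... | true  = z≤n
... | false = s≤s z≤n

capacity-cover-self : ∀ (covered : Fin n → Bool) w → capacity (cover covered w) w ≡ 0
capacity-cover-self covered w rewrite cover-self covered w = refl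

capacity-cover-other : ∀ (covered : Fin n → Bool) {w v} → w ≢ v →
                       capacity (cover covered w) v ≡ capacity covered v
capacity-cover-other covered w≢v rewrite cover-other covered w≢v = refl

positive-capacity⇒uncovered : ∀ (covered : Fin n → Bool) v {m} → suc m ≤ capacity covered v →
                              covered v ≡ false
positive-capacity⇒uncovered covered v _ with covered v
positive-capacity⇒uncovered covered v () | true
... | false = refl

admissible : (Fin n → Bool) → List (Edge n) → Bool
admissible covered []            = true
admissible covered ((_ , w) ∷ F) = not (covered w) ∧ admissible (cover covered w) F

admissible-∷⁺ : ∀ (covered : Fin n → Bool) {u w} F → covered w ≡ false →
                admissible (cover covered w) F ≡ true → admissible covered ((u , w) ∷ F) ≡ true
admissible-∷⁺ covered F cw adm rewrite cw = adm

admissible-∷⁻ : ∀ (covered : Fin n → Bool) {u w} F → admissible covered ((u , w) ∷ F) ≡ true →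
                covered w ≡ false × admissible (cover covered w) F ≡ true
admissible-∷⁻ covered {w = w} F adm with covered w
admissible-∷⁻ covered F () | true
... | false = refl , adm

admissible⇒ : ∀ (covered : Fin n → Bool) F → admissible covered F ≡ true →
              ∀ v → inDegIn F v ≤ capacity covered v
admissible⇒ covered []            _   v = z≤n
admissible⇒ covered ((u , w) ∷ F) adm v with admissible-∷⁻ covered {u} F adm
... | cw , adm′ with w ≟F v
...   | yes refl rewrite cw =
  s≤s (subst (inDegIn F w ≤_) (capacity-cover-self covered w) (admissible⇒ _ F adm′ w))
...   | no w≢v =
  subst (inDegIn F v ≤_) (capacity-cover-other covered w≢v) (admissible⇒ _ F adm′ v)

admissible⇐ : ∀ (covered : Fin n → Bool) F → (∀ v → inDegIn F v ≤ capacity covered v) →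
              admissible covered F ≡ true
admissible⇐ covered []            _     = refl
admissible⇐ covered ((u , w) ∷ F) bound =
  admissible-∷⁺ covered {u} F (positive-capacity⇒uncovered covered w head-bound)
    (admissible⇐ (cover covered w) F (λ v → bound′ v (w ≟F v)))
  where
  head-bound : suc (inDegIn F w) ≤ capacity covered w
  head-bound = subst (_≤ capacity covered w) (inDegIn-∷-head u w F) (bound w)
  bound′ : ∀ v → Dec (w ≡ v) → inDegIn F v ≤ capacity (cover covered w) v
  bound′ _ (yes refl) = subst (inDegIn F w ≤_) (sym (capacity-cover-self covered w))
                          (ℕ.s≤s⁻¹ (≤-trans head-bound (capacity≤1 covered w)))
  bound′ v (no w≢v)   = subst (inDegIn F v ≤_) (sym (capacity-cover-other covered w≢v))
                          (subst (_≤ capacity covered v) (inDegIn-∷-other u F w≢v) (bound v))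

does-⇔ : ∀ {P : Set} (p? : Dec P) {b} → P ⇔ (b ≡ true) → does p? ≡ b
does-⇔ p? {true}  P⇔b = dec-true p? (Equivalence.from P⇔b refl)
does-⇔ p? {false} P⇔b = dec-false p? ((λ ()) ∘ Equivalence.to P⇔b)

forest⇔admissible : ∀ {G : Digraph n} {F} → Acyclic G → F ⊆ edges G →
                    IsDirectedForest F ⇔ (admissible (const false) F ≡ true)
forest⇔admissible {F = F} acyclic F⊆E = mk⇔
  (λ (bound , _) → admissible⇐ (const false) F bound)
  (λ adm → admissible⇒ (const false) F adm , subgraph-acyclic acyclic F⊆E)

weight : (Fin n → Bool) → List (Edge n) → ℤ
weight covered F = if admissible covered F then sgn (length F) else + 0

signedCount : (Fin n → Bool) → List (Edge n) → ℤ
signedCount covered E = sumℤ (map (weight covered) (subsets E))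

signedCount-∷ : ∀ (covered : Fin n → Bool) e E →
  signedCount covered (e ∷ E)
    ≡ signedCount covered E + sumℤ (map (weight covered ∘ (e ∷_)) (subsets E))
signedCount-∷ covered e E = begin
  sumℤ (map (weight covered) (subsets E ++ map (e ∷_) (subsets E)))
    ≡⟨ cong sumℤ (map-++ (weight covered) (subsets E) _) ⟩
  sumℤ (map (weight covered) (subsets E) ++ map (weight covered) (map (e ∷_) (subsets E)))
    ≡⟨ sumℤ-++ (map (weight covered) (subsets E)) _ ⟩
  signedCount covered E + sumℤ (map (weight covered) (map (e ∷_) (subsets E)))
    ≡⟨ cong (λ xs → signedCount covered E + sumℤ xs) (map-∘ (subsets E)) ⟨
  signedCount covered E + sumℤ (map (weight covered ∘ (e ∷_)) (subsets E)) ∎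
  where open ≡-Reasoning

signedCount-∷-covered : ∀ (covered : Fin n → Bool) u {w} E → covered w ≡ true →
  signedCount covered ((u , w) ∷ E) ≡ signedCount covered E
signedCount-∷-covered covered u {w} E cw =
  trans (signedCount-∷ covered (u , w) E)
        (trans (cong (_+_ (signedCount covered E)) (sumℤ-map-zero (subsets E) weight≡0))
               (ℤ.+-identityʳ _))
  where
  weight≡0 : ∀ F → weight covered ((u , w) ∷ F) ≡ + 0
  weight≡0 F rewrite cw = refl

signedCount-∷-uncovered : ∀ (covered : Fin n → Bool) u {w} E → covered w ≡ false →
  signedCount covered ((u , w) ∷ E) ≡ signedCount covered E - signedCount (cover covered w) E
signedCount-∷-uncovered covered u {w} E cw =
  trans (signedCount-∷ covered (u , w) E)
        (cong (_+_ (signedCount covered E))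
              (trans (cong sumℤ (map-cong weight-flips (subsets E)))
                     (sumℤ-map-neg (weight (cover covered w)) (subsets E))))
  where
  weight-flips : ∀ F → weight covered ((u , w) ∷ F) ≡ - weight (cover covered w) F
  weight-flips F rewrite cw = sym (if-float -_ (admissible (cover covered w) F))

factor : (Fin n → Bool) → List (Edge n) → Fin n → ℤ
factor covered E v = if covered v then + 1 else + 1 - + inDegIn E v

factor-[] : ∀ (covered : Fin n → Bool) v → factor covered [] v ≡ + 1
factor-[] covered v with covered v
... | true  = refl
... | false = refl

factor-∷-other : ∀ (covered : Fin n → Bool) u {w v} E → w ≢ v →
                 factor covered ((u , w) ∷ E) v ≡ factor covered E v
factor-∷-other covered u E w≢v rewrite inDegIn-∷-other u E w≢v = refl

factor-∷-covered : ∀ (covered : Fin n → Bool) u {w} E → covered w ≡ true →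
                   ∀ v → factor covered ((u , w) ∷ E) v ≡ factor covered E v
factor-∷-covered covered u {w} E cw v with w ≟F v
... | yes refl rewrite cw = refl
... | no _     = refl

factor-∷-uncovered : ∀ (covered : Fin n → Bool) u {w} E → covered w ≡ false →
  factor covered ((u , w) ∷ E) w ≡ factor covered E w - factor (cover covered w) E w
factor-∷-uncovered covered u {w} E cw
  rewrite cover-self covered w | cw | inDegIn-∷-head u w E = shift (+ inDegIn E w)
  where
  shift : ∀ d → + 1 - (+ 1 + d) ≡ (+ 1 - d) - + 1
  shift = solve-∀

factor-cover-other : ∀ (covered : Fin n → Bool) {w v} E → w ≢ v →
                     factor (cover covered w) E v ≡ factor covered E v
factor-cover-other covered E w≢v rewrite cover-other covered w≢v = refl

signedCount≡∏factor : ∀ (covered : Fin n → Bool) E →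
                      signedCount covered E ≡ ∏ (factor covered E)
signedCount≡∏factor {n} covered [] =
  sym (trans (∏-cong (factor-[] covered)) (∏-replicate-one n))
signedCount≡∏factor covered ((u , w) ∷ E) with covered w in cw
... | true  = begin
  signedCount covered ((u , w) ∷ E) ≡⟨ signedCount-∷-covered covered u E cw ⟩
  signedCount covered E             ≡⟨ signedCount≡∏factor covered E ⟩
  ∏ (factor covered E)              ≡⟨ ∏-cong (factor-∷-covered covered u E cw) ⟨
  ∏ (factor covered ((u , w) ∷ E))  ∎
  where open ≡-Reasoning
... | false = begin
  signedCount covered ((u , w) ∷ E)
    ≡⟨ signedCount-∷-uncovered covered u E cw ⟩
  signedCount covered E - signedCount (cover covered w) E
    ≡⟨ cong₂ _-_ (signedCount≡∏factor covered E) (signedCount≡∏factor (cover covered w) E) ⟩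
  ∏ (factor covered E) - ∏ (factor (cover covered w) E)
    ≡⟨ ∏-split w (factor-∷-uncovered covered u E cw)
               (factor-∷-other covered u E) (factor-cover-other covered E) ⟨
  ∏ (factor covered ((u , w) ∷ E)) ∎
  where open ≡-Reasoning

redEuler≡-signedFaceSum : ∀ (G : Digraph n) dec →
  redEuler G dec ≡ - sumℤ (map (sgn ∘ length) (faces G dec))
redEuler≡-signedFaceSum G dec =
  trans (sumℤ-fibres length (sgn ∘ suc) (suc (length (edges G))) (faces G dec) faces-small)
        (sumℤ-map-neg (sgn ∘ length) (faces G dec))
  where
  faces-small : All (λ F → length F < suc (length (edges G))) (faces G dec)
  faces-small = All.tabulate λ F∈ →
    s≤s (length-mono-≤ (∈-subsets⇒⊆ {E = edges G}
                         (proj₁ (∈-filter⁻ dec {xs = subsets (edges G)} F∈))))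

signedFaceSum≡signedCount : ∀ {G : Digraph n} → Acyclic G →
                            (dec : ∀ F → Dec (IsDirectedForest F)) →
  sumℤ (map (sgn ∘ length) (faces G dec)) ≡ signedCount (const false) (edges G)
signedFaceSum≡signedCount {G = G} acyclic dec =
  trans (sumℤ-map-filter dec (sgn ∘ length) (subsets (edges G)))
        (cong sumℤ (map-cong-local (All.tabulate (λ {F} F∈ →
          cong (λ b → if b then sgn (length F) else + 0)
               (does-⇔ (dec F) (forest⇔admissible acyclic (∈-subsets⇒⊆ F∈)))))))

∏≡productℤ-nonRoots : ∀ (G : Digraph n) →
  ∏ (λ v → + 1 - + inDeg G v) ≡ productℤ (map (λ v → + 1 - + inDeg G v) (nonRoots G))
∏≡productℤ-nonRoots {n} G = sym (begin
  productℤ (map f (nonRoots G))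
    ≡⟨ productℤ-filter (λ v → ¬? (inDeg G v ℕ.≟ 0)) f (allFin n) root⇒1 ⟩
  productℤ (map f (allFin n))
    ≡⟨ cong productℤ (map-tabulate id f) ⟩
  productℤ (tabulate f)
    ≡⟨ productℤ-tabulate f ⟩
  ∏ f ∎)
  where
  open ≡-Reasoning
  f : Fin n → ℤ
  f v = + 1 - + inDeg G v
  root⇒1 : ∀ v → ¬ ¬ inDeg G v ≡ 0 → f v ≡ + 1
  root⇒1 v ¬¬root = cong (λ d → + 1 - + d) (decidable-stable (inDeg G v ℕ.≟ 0) ¬¬root)

lemma2p11 : ∀ (n : ℕ) (G : Digraph n) → Acyclic G →
              (∃₂ λ (u v : Fin n) → G u v ≡ true) →
              (dec : ∀ F → Dec (IsDirectedForest {n} F)) →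
              redEuler G dec
                ≡ - productℤ (map (λ v → + 1 - + inDeg G v) (nonRoots G))
lemma2p11 n G acyclic _ dec = begin
  redEuler G dec
    ≡⟨ redEuler≡-signedFaceSum G dec ⟩
  - sumℤ (map (sgn ∘ length) (faces G dec))
    ≡⟨ cong -_ (signedFaceSum≡signedCount acyclic dec) ⟩
  - signedCount (const false) (edges G)
    ≡⟨ cong -_ (signedCount≡∏factor (const false) (edges G)) ⟩
  - ∏ (λ v → + 1 - + inDegIn (edges G) v)
    ≡⟨ cong -_ (∏-cong (cong (λ d → + 1 - + d) ∘ inDegIn-edges G)) ⟩
  - ∏ (λ v → + 1 - + inDeg G v)
    ≡⟨ cong -_ (∏≡productℤ-nonRoots G) ⟩
  - productℤ (map (λ v → + 1 - + inDeg G v) (nonRoots G)) ∎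
  where open ≡-Reasoning
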